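{- Let $\mathcal{B}\subseteq\mathcal{T}_t$ be a saturated set. Then $\mathcal{B}=\mathcal{T}_t$. In other words, $\mathcal{T}_t$ is the unique saturated set.
   Context: $\lambda\mu$-terms are generated by $\mathcal{T} ::= x \mid \lambda x.\mathcal{T} \mid (\mathcal{T})\mathcal{T} \mid [\alpha]\mathcal{T} \mid \mu\alpha.\mathcal{T}$, where $x$ ranges over $\lambda$-variables and $\alpha$ over $\mu$-variables; $\lambda$ and $\mu$ are binders, terms are identified up to renaming of bound variables, and all substitutions avoid variable capture. Types: $A ::= X \mid \bot \mid A\to B$ with $X$ atomic. Typing judgments $\Gamma\vdash M:A;\Theta$, where $\Gamma$ is a finite set of declarations $x:A$ and $\Theta$ a finite set of declarations $\alpha:B$ (each variable declared at most once), are derived by the rules: $\Gamma,x:A\vdash x:A;\Theta$; from $\Gamma,x:A\vdash M:B;\Theta$ infer $\Gamma\vdash\lambda x.M:A\to B;\Theta$; from $\Gamma\vdash M:A\to B;\Theta$ and $\Gamma\vdash N:A;\Theta$ infer $\Gamma\vdash (M)N:B;\Theta$; from $\Gamma\vdash M:A;\alpha:A,\Theta$ infer $\Gamma\vdash[\alpha]M:\bot;\alpha:A,\Theta$; from $\Gamma\vdash M:\bot;\alpha:A,\Theta$ infer $\Gamma\vdash\mu\alpha.M:A;\Theta$. $\mathcal{T}_t$ is the set of terms $M$ with $\Gamma\vdash M:A;\Theta$ for some $\Gamma,\Theta,A$. For a finite (possibly empty) sequence $\bar P=P_1\dots P_k$ of terms, $(M)\bar P=(\dots((M)P_1)\dots)P_k$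 and $(M)\varnothing=M$; $\mathcal{L}^{<\omega}$ denotes the set of finite sequences of elements of $\mathcal{L}$. $M[x:=N]$ is the usual substitution. For a $\mu$-variable $\alpha$ and a term $N$, $M[\alpha:=_rN]$ is obtained from $M$ by replacing, inductively, every subterm $[\alpha]P$ by $[\alpha](P')N$, where $P'$ is the result of applying the substitution to $P$; for a sequence $\bar N=N_1\dots N_n$, $M[\alpha:=_r\bar N]=M[\alpha:=_rN_1]\dots[\alpha:=_rN_n]$ (so $[\alpha]P$ becomes $[\alpha](P')N_1\dots N_n$). A set $\mathcal{B}\subseteq\mathcal{T}_t$ is saturated if: (C1) for all $M\in\mathcal{B}$ and $\lambda$-variables $x$, $\lambda x.M\in\mathcal{B}$; (C2) for all $M\in\mathcal{B}$ and $\mu$-variables $\alpha$, if $\mu\alpha.M\in\mathcal{T}_t$ then $\mu\alpha.M\in\mathcal{B}$; (C3) for all $M\in\mathcal{B}$ and $\alpha$, if $[\alpha]M\in\mathcal{T}_t$ then $[\alpha]M\in\mathcal{B}$; (C4) for all $n\ge0$, $N_1,\dots,N_n\in\mathcal{B}$ and $\lambda$-variables $x$, if $(x)N_1\dots N_n\in\mathcal{T}_t$ then $(x)N_1\dots N_n\in\mathcal{B}$; (C5) for all $M,N\in\mathcal{T}_t$ and $\bar P\in\mathcal{T}_t^{<\omega}$, if $N\in\mathcal{B}$, $(\lambda x.M)N\bar P\in\mathcal{T}_t$ and $(M[x:=N])\bar P\in\mathcal{B}$, then $(\lambda x.M)N\bar P\in\mathcal{B}$; (C6) for all $M\in\mathcal{T}_t$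 and $\bar N\in\mathcal{B}^{<\omega}$, if $(\mu\alpha.M)\bar N\in\mathcal{T}_t$ and $\mu\alpha.M[\alpha:=_r\bar N]\in\mathcal{B}$, then $(\mu\alpha.M)\bar N\in\mathcal{B}$. -}

module Defs where

open import Data.Nat using (ℕ; zero; suc; _≡ᵇ_)
open import Data.Bool using (if_then_else_)
open import Data.List using (List; []; _∷_; foldl; map)
open import Data.Product using (∃; ∃-syntax; _×_)

-- λμ-terms, locally nameless / de Bruijn style with two separate
-- index spaces: λ-variables (var i) and μ-variables (the α in [α]M).
-- Free variables are identified with their index; bound variables are
-- de Bruijn indices, so α-equivalent terms are syntactically equal.
data Term : Set where
  var  : ℕ → Term
  lam  : Term → Term
  app  : Term → Term → Term
  name : ℕ → Term → Term
  mu   : Term → Term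

data Ty : Set where
  atom : ℕ → Ty
  bot  : Ty
  _⇒_  : Ty → Ty → Ty

infixr 7 _⇒_

Ctx : Set
Ctx = List Ty

data _∋_∶_ : Ctx → ℕ → Ty → Set where
  here  : ∀ {Γ A} → (A ∷ Γ) ∋ zero ∶ A
  there : ∀ {Γ A B i} → Γ ∋ i ∶ A → (B ∷ Γ) ∋ suc i ∶ A

data _⊢_∶_︔_ : Ctx → Term → Ty → Ctx → Set where
  ⊢var  : ∀ {Γ Θ i A} → Γ ∋ i ∶ A → Γ ⊢ var i ∶ A ︔ Θ
  ⊢lam  : ∀ {Γ Θ M A B} → (A ∷ Γ) ⊢ M ∶ B ︔ Θ → Γ ⊢ lam M ∶ (A ⇒ B) ︔ Θ
  ⊢app  : ∀ {Γ Θ M N A B} → Γ ⊢ M ∶ (A ⇒ B) ︔ Θ → Γ ⊢ N ∶ A ︔ Θ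
        → Γ ⊢ app M N ∶ B ︔ Θ
  ⊢name : ∀ {Γ Θ M α A} → Θ ∋ α ∶ A → Γ ⊢ M ∶ A ︔ Θ → Γ ⊢ name α M ∶ bot ︔ Θ
  ⊢mu   : ∀ {Γ Θ M A} → Γ ⊢ M ∶ bot ︔ (A ∷ Θ) → Γ ⊢ mu M ∶ A ︔ Θ

Typable : Term → Set
Typable M = ∃[ Γ ] ∃[ Θ ] ∃[ A ] (Γ ⊢ M ∶ A ︔ Θ)

ext : (ℕ → ℕ) → ℕ → ℕ
ext ρ zero    = zero
ext ρ (suc i) = suc (ρ i)

renλ : (ℕ → ℕ) → Term → Term
renλ ρ (var i)    = var (ρ i)
renλ ρ (lam M)    = lam (renλ (ext ρ) M)
renλ ρ (app M N)  = app (renλ ρ M) (renλ ρ N)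
renλ ρ (name α M) = name α (renλ ρ M)
renλ ρ (mu M)     = mu (renλ ρ M)

renμ : (ℕ → ℕ) → Term → Term
renμ ρ (var i)    = var i
renμ ρ (lam M)    = lam (renμ ρ M)
renμ ρ (app M N)  = app (renμ ρ M) (renμ ρ N)
renμ ρ (name α M) = name (ρ α) (renμ ρ M)
renμ ρ (mu M)     = mu (renμ (ext ρ) M)

exts : (ℕ → Term) → ℕ → Term
exts σ zero    = var zero
exts σ (suc i) = renλ suc (σ i)

substλ : (ℕ → Term) → Term → Term
substλ σ (var i)    = σ i
substλ σ (lam M)    = lam (substλ (exts σ) M)
substλ σ (app M N)  = app (substλ σ M) (substλ σ N)
substλ σ (name α M) = name α (substλ σ M)
substλ σ (mu M)     = mu (substλ (λ i → renμ suc (σ i)) M)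

absλ : ℕ → Term → Term
absλ x M = lam (renλ (λ i → if i ≡ᵇ x then zero else suc i) M)

absμ : ℕ → Term → Term
absμ α M = mu (renμ (λ i → if i ≡ᵇ α then zero else suc i) M)

β-sub : ℕ → Term → Term
β-sub zero    N = N
β-sub (suc i) N = var i

_[0≔_] : Term → Term → Term
M [0≔ N ] = substλ (λ i → β-sub i N) M

structSub : ℕ → Term → Term → Term
structSub α N (var i)    = var i
structSub α N (lam M)    = lam (structSub α (renλ suc N) M)
structSub α N (app M P)  = app (structSub α N M) (structSub α N P)
structSub α N (name β M) =
  if β ≡ᵇ α then name β (app (structSub α N M) N) else name β (structSub α N M)
structSub α N (mu M)     = mu (structSub (suc α) (renμ suc N) M)

structSubs : ℕ → List Term → Term → Term
structSubs α Ns M = foldl (λ P N → structSub α N P) M Ns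

apps : Term → List Term → Term
apps M []       = M
apps M (P ∷ Ps) = apps (app M P) Ps

data AllL (P : Term → Set) : List Term → Set where
  []  : AllL P []
  _∷_ : ∀ {x xs} → P x → AllL P xs → AllL P (x ∷ xs)

record Saturated (B : Term → Set) : Set where
  field
    ⊆typable : ∀ M → B M → Typable M
    C1 : ∀ M x → B M → B (absλ x M)
    C2 : ∀ M α → B M → Typable (absμ α M) → B (absμ α M)
    C3 : ∀ M α → B M → Typable (name α M) → B (name α M)
    C4 : ∀ x Ns → AllL B Ns → Typable (apps (var x) Ns) → B (apps (var x) Ns)
    -- (λx.M) N P̄, with M the body of the abstraction (bound variable = index 0)
    C5 : ∀ M N Ps → Typable M → Typable N → AllL Typable Ps → B N
       → Typable (apps (app (lam M) N) Ps) → B (apps (M [0≔ N ]) Ps)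
       → B (apps (app (lam M) N) Ps)
    -- (μα.M) N̄, with M the body of the μ-abstraction (bound variable = index 0);
    -- N̄ is shifted past the binder, and the contractum is μα.M[α :=_r N̄]
    C6 : ∀ M Ns → Typable M → AllL B Ns → Typable (apps (mu M) Ns)
       → B (mu (structSubs zero (map (renμ suc) Ns) M))
       → B (apps (mu M) Ns)

module Submission where

-- A term M is reducible at type A in contexts Δ ; Ξ if it has
-- that type and (M) N̄ ∈ B for every list N̄ of reducible arguments, in every extension of
-- Δ and Ξ.  Each saturation clause is the closure property needed for one typing rule: C4
-- for variables, C1 and C5 for an abstraction and its β-redexes, C3 for [α]M, and C2 and C6
-- for a μ-abstraction and its μ-redexes, whose contracta are structural substitutions.  By
-- induction on derivations, every typed term becomes reducible under any reducible
-- substitution; since these substitutions must absorb the structural ones, they also append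
-- argument lists at named subterms.  The identity substitution then puts every typable
-- term in B.

open import Defs
open import Data.Nat using (ℕ; zero; suc; _≡ᵇ_; _<_; z≤n; s≤s)
open import Data.Nat.Properties using (<-irrefl; ≡ᵇ⇒≡; ≡⇒≡ᵇ)
open import Data.Bool using (true; false; if_then_else_; T)
open import Data.Bool.Properties using (if-float)
open import Data.List using (List; []; _∷_; map; _++_; length)
open import Data.List.Properties using (++-assoc; ++-identityʳ; map-++; map-cong; map-∘; map-id)
open import Data.List.Relation.Binary.Prefix.Heterogeneous using (Prefix; []; _∷_; _++ᵖ_)
import Data.List.Relation.Binary.Prefix.Heterogeneous.Properties as Prefix
import Data.List.Relation.Binary.Pointwise.Properties as Pointwise
open import Data.Product using (∃-syntax; _×_; _,_; proj₁; proj₂)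
open import Data.Empty using (⊥; ⊥-elim)
open import Function using (_∘_; id; const)
open import Relation.Binary.PropositionalEquality

-- Application spines

apps-++ : ∀ M Ns Ps → apps (apps M Ns) Ps ≡ apps M (Ns ++ Ps)
apps-++ M []       Ps = refl
apps-++ M (N ∷ Ns) Ps = apps-++ (app M N) Ns Ps

apps-hom : ∀ (f : Term → Term) → (∀ M N → f (app M N) ≡ app (f M) (f N))
         → ∀ M Ns → f (apps M Ns) ≡ apps (f M) (map f Ns)
apps-hom f hom M []       = refl
apps-hom f hom M (N ∷ Ns) =
  trans (apps-hom f hom (app M N) Ns) (cong (λ t → apps t (map f Ns)) (hom M N))

map-fusion : ∀ {f g h : Term → Term} → f ∘ g ≗ h → map f ∘ map g ≗ map h
map-fusion H xs = trans (sym (map-∘ xs)) (map-cong H xs)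

map-comm : ∀ {f g f' g' : Term → Term} → f ∘ g ≗ g' ∘ f' → map f ∘ map g ≗ map g' ∘ map f'
map-comm H xs = trans (map-fusion H xs) (map-∘ xs)

-- Renaming

ext-∘ : ∀ {f g h} → f ∘ g ≗ h → ext f ∘ ext g ≗ ext h
ext-∘ H zero    = refl
ext-∘ H (suc i) = cong suc (H i)

ext-id : ∀ {τ} → τ ≗ id → ext τ ≗ id
ext-id H zero    = refl
ext-id H (suc i) = cong suc (H i)

renλ-renλ : ∀ {f g h} → f ∘ g ≗ h → renλ f ∘ renλ g ≗ renλ h
renλ-renλ H (var i)    = cong var (H i)
renλ-renλ H (lam M)    = cong lam (renλ-renλ (ext-∘ H) M)
renλ-renλ H (app M N)  = cong₂ app (renλ-renλ H M) (renλ-renλ H N)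
renλ-renλ H (name α M) = cong (name α) (renλ-renλ H M)
renλ-renλ H (mu M)     = cong mu (renλ-renλ H M)

renμ-renμ : ∀ {f g h} → f ∘ g ≗ h → renμ f ∘ renμ g ≗ renμ h
renμ-renμ H (var i)    = refl
renμ-renμ H (lam M)    = cong lam (renμ-renμ H M)
renμ-renμ H (app M N)  = cong₂ app (renμ-renμ H M) (renμ-renμ H N)
renμ-renμ H (name α M) = cong₂ name (H α) (renμ-renμ H M)
renμ-renμ H (mu M)     = cong mu (renμ-renμ (ext-∘ H) M)

renλ-renμ : ∀ f g → renλ f ∘ renμ g ≗ renμ g ∘ renλ f
renλ-renμ f g (var i)    = refl
renλ-renμ f g (lam M)    = cong lam (renλ-renμ (ext f) g M)
renλ-renμ f g (app M N)  = cong₂ app (renλ-renμ f g M) (renλ-renμ f g N)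
renλ-renμ f g (name α M) = cong (name (g α)) (renλ-renμ f g M)
renλ-renμ f g (mu M)     = cong mu (renλ-renμ f (ext g) M)

renλ-ext-suc : ∀ ρ → renλ (ext ρ) ∘ renλ suc ≗ renλ suc ∘ renλ ρ
renλ-ext-suc ρ M = trans (renλ-renλ (λ _ → refl) M) (sym (renλ-renλ (λ _ → refl) M))

renμ-ext-suc : ∀ ρ → renμ (ext ρ) ∘ renμ suc ≗ renμ suc ∘ renμ ρ
renμ-ext-suc ρ M = trans (renμ-renμ (λ _ → refl) M) (sym (renμ-renμ (λ _ → refl) M))

-- Simultaneous substitution

infixr 5 _▹_

_▹_ : ∀ {X : Set} → X → (ℕ → X) → ℕ → X
(a ▹ f) zero    = a
(a ▹ f) (suc i) = f i

liftArgsλ : (ℕ → List Term) → ℕ → List Term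
liftArgsλ κ β = map (renλ suc) (κ β)

liftEnvμ : (ℕ → Term) → ℕ → Term
liftEnvμ σ i = renμ suc (σ i)

liftArgsμ : (ℕ → List Term) → ℕ → List Term
liftArgsμ κ β = map (renμ suc) (κ β)

-- sub σ τ κ subsumes λ-substitution (σ), μ-renaming (τ) and structural substitution (κ β is
-- appended at every [β]), so the syntactic identities needed below are instances of sub-sub.
sub : (ℕ → Term) → (ℕ → ℕ) → (ℕ → List Term) → Term → Term
sub σ τ κ (var i)    = σ i
sub σ τ κ (lam M)    = lam (sub (exts σ) τ (liftArgsλ κ) M)
sub σ τ κ (app M N)  = app (sub σ τ κ M) (sub σ τ κ N)
sub σ τ κ (name β M) = name (τ β) (apps (sub σ τ κ M) (κ β))
sub σ τ κ (mu M)     = mu (sub (liftEnvμ σ) (ext τ) (liftArgsμ ([] ▹ κ)) M)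

-- sub below a μ-binder whose bound variable receives the arguments Ps
subμ : (ℕ → Term) → (ℕ → ℕ) → (ℕ → List Term) → List Term → Term → Term
subμ σ τ κ Ps = sub (liftEnvμ σ) (ext τ) (liftArgsμ (Ps ▹ κ))

sub-renλ : ∀ {σ σ' τ κ ρ} → σ ∘ ρ ≗ σ' → sub σ τ κ ∘ renλ ρ ≗ sub σ' τ κ
sub-renλ H (var i)    = H i
sub-renλ {σ} {σ'} {ρ = ρ} H (lam M) = cong lam (sub-renλ H' M)
  where
  H' : exts σ ∘ ext ρ ≗ exts σ'
  H' zero    = refl
  H' (suc i) = cong (renλ suc) (H i)
sub-renλ H (app M N)  = cong₂ app (sub-renλ H M) (sub-renλ H N)
sub-renλ {τ = τ} {κ} H (name α M) = cong (λ t → name (τ α) (apps t (κ α))) (sub-renλ H M)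
sub-renλ H (mu M)     = cong mu (sub-renλ (cong (renμ suc) ∘ H) M)

sub-renμ : ∀ {σ τ τ' κ κ' ρ} → τ ∘ ρ ≗ τ' → κ ∘ ρ ≗ κ' → sub σ τ κ ∘ renμ ρ ≗ sub σ τ' κ'
sub-renμ Hτ Hκ (var i)    = refl
sub-renμ Hτ Hκ (lam M)    = cong lam (sub-renμ Hτ (cong (map (renλ suc)) ∘ Hκ) M)
sub-renμ Hτ Hκ (app M N)  = cong₂ app (sub-renμ Hτ Hκ M) (sub-renμ Hτ Hκ N)
sub-renμ Hτ Hκ (name β M) = cong₂ name (Hτ β) (cong₂ apps (sub-renμ Hτ Hκ M) (Hκ β))
sub-renμ {κ = κ} {κ'} {ρ} Hτ Hκ (mu M) = cong mu (sub-renμ (ext-∘ Hτ) Hκ' M)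
  where
  Hκ' : liftArgsμ ([] ▹ κ) ∘ ext ρ ≗ liftArgsμ ([] ▹ κ')
  Hκ' zero    = refl
  Hκ' (suc β) = cong (map (renμ suc)) (Hκ β)

renλ-sub : ∀ {σ σ' τ κ κ' ρ} → renλ ρ ∘ σ ≗ σ' → map (renλ ρ) ∘ κ ≗ κ'
         → renλ ρ ∘ sub σ τ κ ≗ sub σ' τ κ'
renλ-sub Hσ Hκ (var i) = Hσ i
renλ-sub {σ} {σ'} {κ = κ} {κ'} {ρ} Hσ Hκ (lam M) = cong lam (renλ-sub Hσ' Hκ' M)
  where
  Hσ' : renλ (ext ρ) ∘ exts σ ≗ exts σ'
  Hσ' zero    = refl
  Hσ' (suc i) = trans (renλ-ext-suc ρ (σ i)) (cong (renλ suc) (Hσ i))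
  Hκ' : map (renλ (ext ρ)) ∘ liftArgsλ κ ≗ liftArgsλ κ'
  Hκ' β = trans (map-comm (renλ-ext-suc ρ) (κ β)) (cong (map (renλ suc)) (Hκ β))
renλ-sub Hσ Hκ (app M N) = cong₂ app (renλ-sub Hσ Hκ M) (renλ-sub Hσ Hκ N)
renλ-sub {σ} {τ = τ} {κ} {ρ = ρ} Hσ Hκ (name β M) = cong (name (τ β))
  (trans (apps-hom (renλ ρ) (λ _ _ → refl) (sub σ τ κ M) (κ β))
         (cong₂ apps (renλ-sub Hσ Hκ M) (Hκ β)))
renλ-sub {σ} {σ'} {κ = κ} {κ'} {ρ} Hσ Hκ (mu M) = cong mu (renλ-sub Hσ' Hκ' M)
  where
  Hσ' : renλ ρ ∘ liftEnvμ σ ≗ liftEnvμ σ'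
  Hσ' i = trans (renλ-renμ ρ suc (σ i)) (cong (renμ suc) (Hσ i))
  Hκ' : map (renλ ρ) ∘ liftArgsμ ([] ▹ κ) ≗ liftArgsμ ([] ▹ κ')
  Hκ' zero    = refl
  Hκ' (suc β) = trans (map-comm (renλ-renμ ρ suc) (κ β)) (cong (map (renμ suc)) (Hκ β))

renμ-sub : ∀ {σ σ' τ τ' κ κ' ρ} → renμ ρ ∘ σ ≗ σ' → ρ ∘ τ ≗ τ' → map (renμ ρ) ∘ κ ≗ κ'
         → renμ ρ ∘ sub σ τ κ ≗ sub σ' τ' κ'
renμ-sub Hσ Hτ Hκ (var i) = Hσ i
renμ-sub {σ} {σ'} {κ = κ} {κ'} {ρ} Hσ Hτ Hκ (lam M) = cong lam (renμ-sub Hσ' Hτ Hκ' M)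
  where
  Hσ' : renμ ρ ∘ exts σ ≗ exts σ'
  Hσ' zero    = refl
  Hσ' (suc i) = trans (sym (renλ-renμ suc ρ (σ i))) (cong (renλ suc) (Hσ i))
  Hκ' : map (renμ ρ) ∘ liftArgsλ κ ≗ liftArgsλ κ'
  Hκ' β = trans (map-comm (sym ∘ renλ-renμ suc ρ) (κ β)) (cong (map (renλ suc)) (Hκ β))
renμ-sub Hσ Hτ Hκ (app M N) = cong₂ app (renμ-sub Hσ Hτ Hκ M) (renμ-sub Hσ Hτ Hκ N)
renμ-sub {σ} {τ = τ} {κ = κ} {ρ = ρ} Hσ Hτ Hκ (name β M) = cong₂ name (Hτ β)
  (trans (apps-hom (renμ ρ) (λ _ _ → refl) (sub σ τ κ M) (κ β))
         (cong₂ apps (renμ-sub Hσ Hτ Hκ M) (Hκ β)))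
renμ-sub {σ} {σ'} {κ = κ} {κ'} {ρ} Hσ Hτ Hκ (mu M) = cong mu (renμ-sub Hσ' (ext-∘ Hτ) Hκ' M)
  where
  Hσ' : renμ (ext ρ) ∘ liftEnvμ σ ≗ liftEnvμ σ'
  Hσ' i = trans (renμ-ext-suc ρ (σ i)) (cong (renμ suc) (Hσ i))
  Hκ' : map (renμ (ext ρ)) ∘ liftArgsμ ([] ▹ κ) ≗ liftArgsμ ([] ▹ κ')
  Hκ' zero    = refl
  Hκ' (suc β) = trans (map-comm (renμ-ext-suc ρ) (κ β)) (cong (map (renμ suc)) (Hκ β))

map-lift-++ : ∀ (r : Term → Term) {f g : Term → Term} → f ∘ r ≗ r ∘ g
            → ∀ Ns Ps {Qs} → map g Ns ++ Ps ≡ Qs → map f (map r Ns) ++ map r Ps ≡ map r Qs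
map-lift-++ r {f} {g} H Ns Ps {Qs} eq = begin
  map f (map r Ns) ++ map r Ps  ≡⟨ cong (_++ map r Ps) (map-comm H Ns) ⟩
  map r (map g Ns) ++ map r Ps  ≡⟨ sym (map-++ r (map g Ns) Ps) ⟩
  map r (map g Ns ++ Ps)        ≡⟨ cong (map r) eq ⟩
  map r Qs                      ∎
  where open ≡-Reasoning

sub-sub : ∀ {σ₁ τ₁ κ₁ σ₂ τ₂ κ₂ σ₃ τ₃ κ₃}
        → sub σ₂ τ₂ κ₂ ∘ σ₁ ≗ σ₃ → τ₂ ∘ τ₁ ≗ τ₃
        → (∀ β → map (sub σ₂ τ₂ κ₂) (κ₁ β) ++ κ₂ (τ₁ β) ≡ κ₃ β)
        → sub σ₂ τ₂ κ₂ ∘ sub σ₁ τ₁ κ₁ ≗ sub σ₃ τ₃ κ₃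
sub-sub Hσ Hτ Hκ (var i) = Hσ i
sub-sub {σ₁} {τ₁} {κ₁} {σ₂} {τ₂} {κ₂} {σ₃} Hσ Hτ Hκ (lam M) = cong lam
  (sub-sub Hσ' Hτ (λ β → map-lift-++ (renλ suc) comm (κ₁ β) (κ₂ (τ₁ β)) (Hκ β)) M)
  where
  comm : sub (exts σ₂) τ₂ (liftArgsλ κ₂) ∘ renλ suc ≗ renλ suc ∘ sub σ₂ τ₂ κ₂
  comm M = trans (sub-renλ (λ _ → refl) M) (sym (renλ-sub (λ _ → refl) (λ _ → refl) M))
  Hσ' : sub (exts σ₂) τ₂ (liftArgsλ κ₂) ∘ exts σ₁ ≗ exts σ₃
  Hσ' zero    = refl
  Hσ' (suc i) = trans (comm (σ₁ i)) (cong (renλ suc) (Hσ i))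
sub-sub Hσ Hτ Hκ (app M N) = cong₂ app (sub-sub Hσ Hτ Hκ M) (sub-sub Hσ Hτ Hκ N)
sub-sub {σ₁} {τ₁} {κ₁} {σ₂} {τ₂} {κ₂} Hσ Hτ Hκ (name β M) = cong₂ name (Hτ β) (begin
  apps (sub σ₂ τ₂ κ₂ (apps (sub σ₁ τ₁ κ₁ M) (κ₁ β))) (κ₂ (τ₁ β))
    ≡⟨ cong (λ t → apps t (κ₂ (τ₁ β))) (apps-hom (sub σ₂ τ₂ κ₂) (λ _ _ → refl) _ (κ₁ β)) ⟩
  apps (apps (sub σ₂ τ₂ κ₂ (sub σ₁ τ₁ κ₁ M)) (map (sub σ₂ τ₂ κ₂) (κ₁ β))) (κ₂ (τ₁ β))
    ≡⟨ apps-++ _ (map (sub σ₂ τ₂ κ₂) (κ₁ β)) (κ₂ (τ₁ β)) ⟩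
  apps (sub σ₂ τ₂ κ₂ (sub σ₁ τ₁ κ₁ M)) (map (sub σ₂ τ₂ κ₂) (κ₁ β) ++ κ₂ (τ₁ β))
    ≡⟨ cong₂ apps (sub-sub Hσ Hτ Hκ M) (Hκ β) ⟩
  _ ∎)
  where open ≡-Reasoning
sub-sub {σ₁} {τ₁} {κ₁} {σ₂} {τ₂} {κ₂} {σ₃} {κ₃ = κ₃} Hσ Hτ Hκ (mu M) =
  cong mu (sub-sub Hσ' (ext-∘ Hτ) Hκ' M)
  where
  comm : sub (liftEnvμ σ₂) (ext τ₂) (liftArgsμ ([] ▹ κ₂)) ∘ renμ suc ≗ renμ suc ∘ sub σ₂ τ₂ κ₂
  comm M = trans (sub-renμ (λ _ → refl) (λ _ → refl) M)
                 (sym (renμ-sub (λ _ → refl) (λ _ → refl) (λ _ → refl) M))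
  Hσ' : sub (liftEnvμ σ₂) (ext τ₂) (liftArgsμ ([] ▹ κ₂)) ∘ liftEnvμ σ₁ ≗ liftEnvμ σ₃
  Hσ' i = trans (comm (σ₁ i)) (cong (renμ suc) (Hσ i))
  Hκ' : ∀ β → map (sub (liftEnvμ σ₂) (ext τ₂) (liftArgsμ ([] ▹ κ₂))) (liftArgsμ ([] ▹ κ₁) β)
                 ++ liftArgsμ ([] ▹ κ₂) (ext τ₁ β) ≡ liftArgsμ ([] ▹ κ₃) β
  Hκ' zero    = refl
  Hκ' (suc β) = map-lift-++ (renμ suc) comm (κ₁ β) (κ₂ (τ₁ β)) (Hκ β)

exts-var : ∀ {σ} → σ ≗ var → exts σ ≗ var
exts-var H zero    = refl
exts-var H (suc i) = cong (renλ suc) (H i)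

liftArgsμ-none : ∀ {κ} → κ ≗ const [] → liftArgsμ ([] ▹ κ) ≗ const []
liftArgsμ-none H zero    = refl
liftArgsμ-none H (suc β) = cong (map (renμ suc)) (H β)

sub-id : ∀ {σ τ κ} → σ ≗ var → τ ≗ id → κ ≗ const [] → sub σ τ κ ≗ id
sub-id Hσ Hτ Hκ (var i)    = Hσ i
sub-id Hσ Hτ Hκ (lam M)    = cong lam (sub-id (exts-var Hσ) Hτ (cong (map (renλ suc)) ∘ Hκ) M)
sub-id Hσ Hτ Hκ (app M N)  = cong₂ app (sub-id Hσ Hτ Hκ M) (sub-id Hσ Hτ Hκ N)
sub-id Hσ Hτ Hκ (name β M) = cong₂ name (Hτ β) (trans (cong (apps _) (Hκ β)) (sub-id Hσ Hτ Hκ M))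
sub-id Hσ Hτ Hκ (mu M)     =
  cong mu (sub-id (cong (renμ suc) ∘ Hσ) (ext-id Hτ) (liftArgsμ-none Hκ) M)

substλ-as-sub : ∀ {σ τ κ} → τ ≗ id → κ ≗ const [] → substλ σ ≗ sub σ τ κ
substλ-as-sub Hτ Hκ (var i) = refl
substλ-as-sub Hτ Hκ (lam M) = cong lam (substλ-as-sub Hτ (cong (map (renλ suc)) ∘ Hκ) M)
substλ-as-sub Hτ Hκ (app M N) = cong₂ app (substλ-as-sub Hτ Hκ M) (substλ-as-sub Hτ Hκ N)
substλ-as-sub Hτ Hκ (name β M) =
  cong₂ name (sym (Hτ β)) (trans (substλ-as-sub Hτ Hκ M) (cong (apps _) (sym (Hκ β))))
substλ-as-sub Hτ Hκ (mu M) = cong mu (substλ-as-sub (ext-id Hτ) (liftArgsμ-none Hκ) M)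

renμ-as-sub : ∀ ρ → renμ ρ ≗ sub var ρ (const [])
renμ-as-sub ρ M = begin
  renμ ρ M
    ≡⟨ cong (renμ ρ) (sym (sub-id (λ _ → refl) (λ _ → refl) (λ _ → refl) M)) ⟩
  renμ ρ (sub var id (const []) M)
    ≡⟨ renμ-sub (λ _ → refl) (λ _ → refl) (λ _ → refl) M ⟩
  sub var ρ (const []) M
    ∎
  where open ≡-Reasoning

argAt : ℕ → Term → ℕ → List Term
argAt α N β = if β ≡ᵇ α then N ∷ [] else []

structSub-as-sub : ∀ {σ τ κ} α N → σ ≗ var → τ ≗ id → κ ≗ argAt α N → structSub α N ≗ sub σ τ κ
structSub-as-sub α N Hσ Hτ Hκ (var i) = sym (Hσ i)
structSub-as-sub {κ = κ} α N Hσ Hτ Hκ (lam M) =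
  cong lam (structSub-as-sub α (renλ suc N) (exts-var Hσ) Hτ Hκ' M)
  where
  Hκ' : liftArgsλ κ ≗ argAt α (renλ suc N)
  Hκ' β = trans (cong (map (renλ suc)) (Hκ β)) (if-float (map (renλ suc)) (β ≡ᵇ α))
structSub-as-sub α N Hσ Hτ Hκ (app M P) =
  cong₂ app (structSub-as-sub α N Hσ Hτ Hκ M) (structSub-as-sub α N Hσ Hτ Hκ P)
structSub-as-sub α N Hσ Hτ Hκ (name β M) with β ≡ᵇ α | Hκ β
... | true  | eq = cong₂ name (sym (Hτ β))
  (trans (cong (λ t → app t N) (structSub-as-sub α N Hσ Hτ Hκ M)) (cong (apps _) (sym eq)))
... | false | eq = cong₂ name (sym (Hτ β))
  (trans (structSub-as-sub α N Hσ Hτ Hκ M) (cong (apps _) (sym eq)))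
structSub-as-sub {κ = κ} α N Hσ Hτ Hκ (mu M) =
  cong mu (structSub-as-sub (suc α) (renμ suc N) (cong (renμ suc) ∘ Hσ) (ext-id Hτ) Hκ' M)
  where
  Hκ' : liftArgsμ ([] ▹ κ) ≗ argAt (suc α) (renμ suc N)
  Hκ' zero    = refl
  Hκ' (suc β) = trans (cong (map (renμ suc)) (Hκ β)) (if-float (map (renμ suc)) (β ≡ᵇ α))

sub-β : ∀ σ τ κ N M → sub (exts σ) τ (liftArgsλ κ) M [0≔ N ] ≡ sub (N ▹ σ) τ κ M
sub-β σ τ κ N M =
  trans (substλ-as-sub (λ _ → refl) (λ _ → refl) (sub (exts σ) τ (liftArgsλ κ) M))
        (sub-sub Hσ (λ _ → refl) Hκ M)
  where
  drop : sub (λ i → β-sub i N) id (const []) ∘ renλ suc ≗ id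
  drop x = trans (sub-renλ (λ _ → refl) x) (sub-id (λ _ → refl) (λ _ → refl) (λ _ → refl) x)
  Hσ : sub (λ i → β-sub i N) id (const []) ∘ exts σ ≗ N ▹ σ
  Hσ zero    = refl
  Hσ (suc i) = drop (σ i)
  Hκ : ∀ β → map (sub (λ i → β-sub i N) id (const [])) (liftArgsλ κ β) ++ [] ≡ κ β
  Hκ β = trans (++-identityʳ _) (trans (map-fusion drop (κ β)) (map-id (κ β)))

structSub-subμ : ∀ σ τ κ Ps N M
               → structSub zero (renμ suc N) (subμ σ τ κ Ps M) ≡ subμ σ τ κ (Ps ++ N ∷ []) M
structSub-subμ σ τ κ Ps N M =
  trans (structSub-as-sub zero (renμ suc N) (λ _ → refl) (λ _ → refl) (λ _ → refl)
                          (subμ σ τ κ Ps M))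
        (sub-sub (keep ∘ σ) (λ _ → refl) Hκ M)
  where
  keep : sub var id (argAt zero (renμ suc N)) ∘ renμ suc ≗ renμ suc
  keep x = trans (sub-renμ (λ _ → refl) (λ _ → refl) x) (sym (renμ-as-sub suc x))
  Hκ : ∀ β → map (sub var id (argAt zero (renμ suc N))) (liftArgsμ (Ps ▹ κ) β)
             ++ argAt zero (renμ suc N) (ext τ β) ≡ liftArgsμ ((Ps ++ N ∷ []) ▹ κ) β
  Hκ zero    = trans (cong (_++ _) (map-fusion keep Ps)) (sym (map-++ (renμ suc) Ps (N ∷ [])))
  Hκ (suc β) = trans (++-identityʳ _) (map-fusion keep (κ β))

structSubs-subμ : ∀ σ τ κ Ps Ns M
                → structSubs zero (map (renμ suc) Ns) (subμ σ τ κ Ps M) ≡ subμ σ τ κ (Ps ++ Ns) M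
structSubs-subμ σ τ κ Ps [] M = cong (λ Qs → subμ σ τ κ Qs M) (sym (++-identityʳ Ps))
structSubs-subμ σ τ κ Ps (N ∷ Ns) M = begin
  structSubs zero (map (renμ suc) Ns) (structSub zero (renμ suc N) (subμ σ τ κ Ps M))
    ≡⟨ cong (structSubs zero (map (renμ suc) Ns)) (structSub-subμ σ τ κ Ps N M) ⟩
  structSubs zero (map (renμ suc) Ns) (subμ σ τ κ (Ps ++ N ∷ []) M)
    ≡⟨ structSubs-subμ σ τ κ (Ps ++ N ∷ []) Ns M ⟩
  subμ σ τ κ ((Ps ++ N ∷ []) ++ Ns) M
    ≡⟨ cong (λ Qs → subμ σ τ κ Qs M) (++-assoc Ps (N ∷ []) Ns) ⟩
  subμ σ τ κ (Ps ++ N ∷ Ns) M ∎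
  where open ≡-Reasoning

-- Scoping and freshness

absRen : ℕ → ℕ → ℕ
absRen x i = if i ≡ᵇ x then zero else suc i

absRen-self : ∀ x → absRen x x ≡ zero
absRen-self x with x ≡ᵇ x | ≡⇒≡ᵇ x x refl
... | true | _ = refl

absRen-< : ∀ {i x} → i < x → absRen x i ≡ suc i
absRen-< {i} {x} i<x with i ≡ᵇ x in eq
... | true  = ⊥-elim (<-irrefl (≡ᵇ⇒≡ i x (subst T (sym eq) _)) i<x)
... | false = refl

infix 4 _≗_on_

_≗_on_ : ∀ {X : Set} → (ℕ → X) → (ℕ → X) → Ctx → Set
f ≗ g on Γ = ∀ {i A} → Γ ∋ i ∶ A → f i ≡ g i

∋-< : ∀ {Γ i A} → Γ ∋ i ∶ A → i < length Γ
∋-< here      = s≤s z≤n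
∋-< (there r) = s≤s (∋-< r)

absRen-fresh : ∀ Γ → absRen (length Γ) ≗ suc on Γ
absRen-fresh Γ r = absRen-< (∋-< r)

ext-cong-on : ∀ {Γ A f g} → f ≗ g on Γ → ext f ≗ ext g on (A ∷ Γ)
ext-cong-on H here      = refl
ext-cong-on H (there r) = cong suc (H r)

renλ-cong-⊢ : ∀ {Γ Θ M A f g} → Γ ⊢ M ∶ A ︔ Θ → f ≗ g on Γ → renλ f M ≡ renλ g M
renλ-cong-⊢ (⊢var r)    H = cong var (H r)
renλ-cong-⊢ (⊢lam d)    H = cong lam (renλ-cong-⊢ d (ext-cong-on H))
renλ-cong-⊢ (⊢app d e)  H = cong₂ app (renλ-cong-⊢ d H) (renλ-cong-⊢ e H)
renλ-cong-⊢ (⊢name r d) H = cong (name _) (renλ-cong-⊢ d H)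
renλ-cong-⊢ (⊢mu d)     H = cong mu (renλ-cong-⊢ d H)

renμ-cong-⊢ : ∀ {Γ Θ M A f g} → Γ ⊢ M ∶ A ︔ Θ → f ≗ g on Θ → renμ f M ≡ renμ g M
renμ-cong-⊢ (⊢var r)    H = refl
renμ-cong-⊢ (⊢lam d)    H = cong lam (renμ-cong-⊢ d H)
renμ-cong-⊢ (⊢app d e)  H = cong₂ app (renμ-cong-⊢ d H) (renμ-cong-⊢ e H)
renμ-cong-⊢ (⊢name r d) H = cong₂ name (H r) (renμ-cong-⊢ d H)
renμ-cong-⊢ (⊢mu d)     H = cong mu (renμ-cong-⊢ d (ext-cong-on H))

sub-cong-⊢ : ∀ {Γ Θ M A σ σ' τ τ' κ κ'} → Γ ⊢ M ∶ A ︔ Θ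
           → σ ≗ σ' on Γ → τ ≗ τ' on Θ → κ ≗ κ' on Θ → sub σ τ κ M ≡ sub σ' τ' κ' M
sub-cong-⊢ (⊢var r) Hσ Hτ Hκ = Hσ r
sub-cong-⊢ {Γ} {σ = σ} {σ'} (⊢lam {A = A} d) Hσ Hτ Hκ =
  cong lam (sub-cong-⊢ d Hσ' Hτ (cong (map (renλ suc)) ∘ Hκ))
  where
  Hσ' : exts σ ≗ exts σ' on (A ∷ Γ)
  Hσ' here      = refl
  Hσ' (there r) = cong (renλ suc) (Hσ r)
sub-cong-⊢ (⊢app d e) Hσ Hτ Hκ = cong₂ app (sub-cong-⊢ d Hσ Hτ Hκ) (sub-cong-⊢ e Hσ Hτ Hκ)
sub-cong-⊢ (⊢name r d) Hσ Hτ Hκ = cong₂ name (Hτ r) (cong₂ apps (sub-cong-⊢ d Hσ Hτ Hκ) (Hκ r))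
sub-cong-⊢ {Θ = Θ} {κ = κ} {κ'} (⊢mu {A = A} d) Hσ Hτ Hκ =
  cong mu (sub-cong-⊢ d (cong (renμ suc) ∘ Hσ) (ext-cong-on Hτ) Hκ')
  where
  Hκ' : liftArgsμ ([] ▹ κ) ≗ liftArgsμ ([] ▹ κ') on (A ∷ Θ)
  Hκ' here      = refl
  Hκ' (there r) = cong (map (renμ suc)) (Hκ r)

absλ-sub : ∀ {Γ Θ M A B σ τ κ} x → (A ∷ Γ) ⊢ M ∶ B ︔ Θ
         → renλ (absRen x) ∘ σ ≗ renλ suc ∘ σ on Γ
         → map (renλ (absRen x)) ∘ κ ≗ liftArgsλ κ on Θ
         → absλ x (sub (var x ▹ σ) τ κ M) ≡ sub σ τ κ (lam M)
absλ-sub {Γ} {M = M} {A} {σ = σ} x d Hσ Hκ =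
  cong lam (trans (renλ-sub (λ _ → refl) (λ _ → refl) M) (sub-cong-⊢ d Hσ' (λ _ → refl) Hκ))
  where
  Hσ' : renλ (absRen x) ∘ (var x ▹ σ) ≗ exts σ on (A ∷ Γ)
  Hσ' here      = cong var (absRen-self x)
  Hσ' (there r) = Hσ r

absμ-sub : ∀ {Γ Θ M A σ τ κ} γ Ns → Γ ⊢ M ∶ bot ︔ (A ∷ Θ)
         → renμ (absRen γ) ∘ σ ≗ liftEnvμ σ on Γ
         → absRen γ ∘ τ ≗ suc ∘ τ on Θ
         → map (renμ (absRen γ)) ∘ κ ≗ liftArgsμ κ on Θ
         → map (renμ (absRen γ)) Ns ≡ map (renμ suc) Ns
         → absμ γ (sub σ (γ ▹ τ) (Ns ▹ κ) M) ≡ mu (subμ σ τ κ Ns M)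
absμ-sub {Θ = Θ} {M} {A} {τ = τ} {κ} γ Ns d Hσ Hτ Hκ HNs =
  cong mu (trans (renμ-sub (λ _ → refl) (λ _ → refl) (λ _ → refl) M) (sub-cong-⊢ d Hσ Hτ' Hκ'))
  where
  Hτ' : absRen γ ∘ (γ ▹ τ) ≗ ext τ on (A ∷ Θ)
  Hτ' here      = absRen-self γ
  Hτ' (there r) = Hτ r
  Hκ' : map (renμ (absRen γ)) ∘ (Ns ▹ κ) ≗ liftArgsμ (Ns ▹ κ) on (A ∷ Θ)
  Hκ' here      = HNs
  Hκ' (there r) = Hκ r

-- Typing

infix 4 _⊑_

_⊑_ : Ctx → Ctx → Set
_⊑_ = Prefix _≡_

⊑-refl : ∀ {Δ} → Δ ⊑ Δ
⊑-refl = Prefix.fromPointwise (Pointwise.refl refl)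

⊑-trans : ∀ {Δ₁ Δ₂ Δ₃} → Δ₁ ⊑ Δ₂ → Δ₂ ⊑ Δ₃ → Δ₁ ⊑ Δ₃
⊑-trans = Prefix.trans trans

⊑-++ : ∀ {Δ E} → Δ ⊑ Δ ++ E
⊑-++ = ⊑-refl ++ᵖ _

∋-⊑ : ∀ {Δ Δ' i A} → Δ ⊑ Δ' → Δ ∋ i ∶ A → Δ' ∋ i ∶ A
∋-⊑ (refl ∷ p) here      = here
∋-⊑ (refl ∷ p) (there r) = there (∋-⊑ p r)

⊢-⊑ : ∀ {Γ Γ' Θ Θ' M A} → Γ ⊑ Γ' → Θ ⊑ Θ' → Γ ⊢ M ∶ A ︔ Θ → Γ' ⊢ M ∶ A ︔ Θ'
⊢-⊑ p q (⊢var r)    = ⊢var (∋-⊑ p r)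
⊢-⊑ p q (⊢lam d)    = ⊢lam (⊢-⊑ (refl ∷ p) q d)
⊢-⊑ p q (⊢app d e)  = ⊢app (⊢-⊑ p q d) (⊢-⊑ p q e)
⊢-⊑ p q (⊢name r d) = ⊢name (∋-⊑ q r) (⊢-⊑ p q d)
⊢-⊑ p q (⊢mu d)     = ⊢mu (⊢-⊑ p (refl ∷ q) d)

∋-last : ∀ Δ {A} → (Δ ++ A ∷ []) ∋ length Δ ∶ A
∋-last []      = here
∋-last (B ∷ Δ) = there (∋-last Δ)

∋-absRen : ∀ Δ {A i B} → (Δ ++ A ∷ []) ∋ i ∶ B → (A ∷ Δ) ∋ absRen (length Δ) i ∶ B
∋-absRen []      here      = here
∋-absRen (C ∷ Δ) here      = there here
∋-absRen (C ∷ Δ) {i = suc i} (there r) with i ≡ᵇ length Δ | ∋-absRen Δ r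
... | true  | here    = here
... | false | there h = there (there h)

infix 4 _∶_↪_

_∶_↪_ : (ℕ → ℕ) → Ctx → Ctx → Set
ρ ∶ Γ ↪ Γ' = ∀ {i B} → Γ ∋ i ∶ B → Γ' ∋ ρ i ∶ B

ext-↪ : ∀ {ρ Γ Γ' A} → ρ ∶ Γ ↪ Γ' → ext ρ ∶ (A ∷ Γ) ↪ (A ∷ Γ')
ext-↪ H here      = here
ext-↪ H (there r) = there (H r)

⊢-renλ : ∀ {Γ Γ' Θ M A ρ} → ρ ∶ Γ ↪ Γ' → Γ ⊢ M ∶ A ︔ Θ → Γ' ⊢ renλ ρ M ∶ A ︔ Θ
⊢-renλ H (⊢var r)    = ⊢var (H r)
⊢-renλ H (⊢lam d)    = ⊢lam (⊢-renλ (ext-↪ H) d)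
⊢-renλ H (⊢app d e)  = ⊢app (⊢-renλ H d) (⊢-renλ H e)
⊢-renλ H (⊢name r d) = ⊢name r (⊢-renλ H d)
⊢-renλ H (⊢mu d)     = ⊢mu (⊢-renλ H d)

⊢-renμ : ∀ {Γ Θ Θ' M A ρ} → ρ ∶ Θ ↪ Θ' → Γ ⊢ M ∶ A ︔ Θ → Γ ⊢ renμ ρ M ∶ A ︔ Θ'
⊢-renμ H (⊢var r)    = ⊢var r
⊢-renμ H (⊢lam d)    = ⊢lam (⊢-renμ H d)
⊢-renμ H (⊢app d e)  = ⊢app (⊢-renμ H d) (⊢-renμ H e)
⊢-renμ H (⊢name r d) = ⊢name (H r) (⊢-renμ H d)
⊢-renμ H (⊢mu d)     = ⊢mu (⊢-renμ (ext-↪ H) d)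

⊢-absλ : ∀ {Δ Ξ M A B} → (Δ ++ A ∷ []) ⊢ M ∶ B ︔ Ξ → Δ ⊢ absλ (length Δ) M ∶ A ⇒ B ︔ Ξ
⊢-absλ {Δ} d = ⊢lam (⊢-renλ (∋-absRen Δ) d)

⊢-absμ : ∀ {Δ Ξ M A} → Δ ⊢ M ∶ bot ︔ (Ξ ++ A ∷ []) → Δ ⊢ absμ (length Ξ) M ∶ A ︔ Ξ
⊢-absμ {Ξ = Ξ} d = ⊢mu (⊢-renμ (∋-absRen Ξ) d)

data TypedArgs (Δ Ξ : Ctx) : Ty → List Term → Ty → Set where
  []  : ∀ {A} → TypedArgs Δ Ξ A [] A
  _∷_ : ∀ {A B C N Ns} → Δ ⊢ N ∶ A ︔ Ξ → TypedArgs Δ Ξ B Ns C → TypedArgs Δ Ξ (A ⇒ B) (N ∷ Ns) C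

⊢-apps : ∀ {Δ Ξ A C M Ns} → Δ ⊢ M ∶ A ︔ Ξ → TypedArgs Δ Ξ A Ns C → Δ ⊢ apps M Ns ∶ C ︔ Ξ
⊢-apps d []       = d
⊢-apps d (e ∷ es) = ⊢-apps (⊢app d e) es

typable : ∀ {Δ Ξ M A} → Δ ⊢ M ∶ A ︔ Ξ → Typable M
typable d = _ , _ , _ , d

typable-lam⁻ : ∀ {Δ Ξ M A} → Δ ⊢ lam M ∶ A ︔ Ξ → Typable M
typable-lam⁻ (⊢lam d) = typable d

typable-mu⁻ : ∀ {Δ Ξ M A} → Δ ⊢ mu M ∶ A ︔ Ξ → Typable M
typable-mu⁻ (⊢mu d) = typable d

typedArgs-typable : ∀ {Δ Ξ A Ns C} → TypedArgs Δ Ξ A Ns C → AllL Typable Ns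
typedArgs-typable []       = []
typedArgs-typable (d ∷ es) = typable d ∷ typedArgs-typable es

freshλ : ∀ {Δ Ξ M A} → Δ ⊢ M ∶ A ︔ Ξ → renλ (absRen (length Δ)) M ≡ renλ suc M
freshλ {Δ} d = renλ-cong-⊢ d (absRen-fresh Δ)

freshμ : ∀ {Δ Ξ M A} → Δ ⊢ M ∶ A ︔ Ξ → renμ (absRen (length Ξ)) M ≡ renμ suc M
freshμ {Ξ = Ξ} d = renμ-cong-⊢ d (absRen-fresh Ξ)

freshλ-args : ∀ {Δ Ξ A Ns C} → TypedArgs Δ Ξ A Ns C
            → map (renλ (absRen (length Δ))) Ns ≡ map (renλ suc) Ns
freshλ-args []       = refl
freshλ-args (d ∷ es) = cong₂ _∷_ (freshλ d) (freshλ-args es)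

freshμ-args : ∀ {Δ Ξ A Ns C} → TypedArgs Δ Ξ A Ns C
            → map (renμ (absRen (length Ξ))) Ns ≡ map (renμ suc) Ns
freshμ-args []       = refl
freshμ-args (d ∷ es) = cong₂ _∷_ (freshμ d) (freshμ-args es)

-- Reducibility

module Reducibility (B : Term → Set) (S : Saturated B) where
  open Saturated S

  -- Extensions are by prefix: the fresh variable needed for C1 and C2 is the one with index
  -- length Δ, which is fresh for every term typed in Δ.
  mutual
    Red : Ctx → Ctx → Ty → Term → Set
    Red Δ Ξ A M = Δ ⊢ M ∶ A ︔ Ξ × AppsInB Δ Ξ A M

    AppsInB : Ctx → Ctx → Ty → Term → Set
    AppsInB Δ Ξ A M = ∀ {Δ' Ξ'} → Δ ⊑ Δ' → Ξ ⊑ Ξ' → ∀ C Ns → RedArgs Δ' Ξ' A Ns C → B (apps M Ns)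

    RedArgs : Ctx → Ctx → Ty → List Term → Ty → Set
    RedArgs Δ Ξ A          []       C = A ≡ C
    RedArgs Δ Ξ (A ⇒ A')   (N ∷ Ns) C = Red Δ Ξ A N × RedArgs Δ Ξ A' Ns C
    RedArgs Δ Ξ (atom _)   (N ∷ Ns) C = ⊥
    RedArgs Δ Ξ bot        (N ∷ Ns) C = ⊥

  red-⊑ : ∀ {Δ Δ' Ξ Ξ' A M} → Δ ⊑ Δ' → Ξ ⊑ Ξ' → Red Δ Ξ A M → Red Δ' Ξ' A M
  red-⊑ p q (d , inB) = ⊢-⊑ p q d , λ p' q' → inB (⊑-trans p p') (⊑-trans q q')

  redArgs-⊑ : ∀ {Δ Δ' Ξ Ξ' A Ns C} → Δ ⊑ Δ' → Ξ ⊑ Ξ' → RedArgs Δ Ξ A Ns C → RedArgs Δ' Ξ' A Ns C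
  redArgs-⊑ {Ns = []}             p q eq        = eq
  redArgs-⊑ {A = A ⇒ A'} {N ∷ Ns} p q (rN , rs) = red-⊑ p q rN , redArgs-⊑ {A = A'} p q rs

  redArgs-typed : ∀ {Δ Ξ A Ns C} → RedArgs Δ Ξ A Ns C → TypedArgs Δ Ξ A Ns C
  redArgs-typed {Ns = []}             refl      = []
  redArgs-typed {A = A ⇒ A'} {N ∷ Ns} (rN , rs) = proj₁ rN ∷ redArgs-typed {A = A'} rs

  red-inB : ∀ {Δ Ξ A M} → Red Δ Ξ A M → B M
  red-inB {A = A} (_ , inB) = inB ⊑-refl ⊑-refl A [] refl

  redArgs-inB : ∀ {Δ Ξ A Ns C} → RedArgs Δ Ξ A Ns C → AllL B Ns
  redArgs-inB {Ns = []}             _         = []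
  redArgs-inB {A = A ⇒ A'} {N ∷ Ns} (rN , rs) = red-inB rN ∷ redArgs-inB {A = A'} rs

  red-var : ∀ {Δ Ξ x A} → Δ ∋ x ∶ A → Red Δ Ξ A (var x)
  red-var {x = x} r = ⊢var r , λ p q C Ns rs →
    C4 x Ns (redArgs-inB rs) (typable (⊢-apps (⊢var (∋-⊑ p r)) (redArgs-typed rs)))

  red-app : ∀ {Δ Ξ A A' M N} → Red Δ Ξ (A ⇒ A') M → Red Δ Ξ A N → Red Δ Ξ A' (app M N)
  red-app (dM , inB) rN@(dN , _) =
    ⊢app dM dN , λ p q C Ns rs → inB p q C (_ ∷ Ns) (red-⊑ p q rN , rs)

  red-name : ∀ {Δ Ξ A C α M Ns} → Ξ ∋ α ∶ C → Red Δ Ξ A M → RedArgs Δ Ξ A Ns C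
           → Red Δ Ξ bot (name α (apps M Ns))
  red-name {Δ} {Ξ} {α = α} {M} {Ns} r (dM , inB) rs = d , inB'
    where
    d : Δ ⊢ name α (apps M Ns) ∶ bot ︔ Ξ
    d = ⊢name r (⊢-apps dM (redArgs-typed rs))
    inB' : AppsInB Δ Ξ bot (name α (apps M Ns))
    inB' p q C [] refl = C3 _ α (inB ⊑-refl ⊑-refl _ Ns rs) (typable (⊢-⊑ p q d))

  RedEnvλ : Ctx → Ctx → Ctx → (ℕ → Term) → Set
  RedEnvλ Γ Δ Ξ σ = ∀ {i A} → Γ ∋ i ∶ A → Red Δ Ξ A (σ i)

  RedEnvμ : Ctx → Ctx → Ctx → (ℕ → ℕ) → (ℕ → List Term) → Set
  RedEnvμ Θ Δ Ξ τ κ = ∀ {β A} → Θ ∋ β ∶ A → ∃[ C ] (Ξ ∋ τ β ∶ C × RedArgs Δ Ξ A (κ β) C)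

  redEnvλ-⊑ : ∀ {Γ Δ Δ' Ξ Ξ' σ} → Δ ⊑ Δ' → Ξ ⊑ Ξ' → RedEnvλ Γ Δ Ξ σ → RedEnvλ Γ Δ' Ξ' σ
  redEnvλ-⊑ p q Hσ r = red-⊑ p q (Hσ r)

  redEnvμ-⊑ : ∀ {Θ Δ Δ' Ξ Ξ' τ κ} → Δ ⊑ Δ' → Ξ ⊑ Ξ' → RedEnvμ Θ Δ Ξ τ κ → RedEnvμ Θ Δ' Ξ' τ κ
  redEnvμ-⊑ p q Hτ r with Hτ r
  ... | C , r' , rs = C , ∋-⊑ q r' , redArgs-⊑ p q rs

  infix 3 _⊨_∶_︔_

  _⊨_∶_︔_ : Ctx → Term → Ty → Ctx → Set
  Γ ⊨ M ∶ A ︔ Θ = ∀ {Δ Ξ σ τ κ} → RedEnvλ Γ Δ Ξ σ → RedEnvμ Θ Δ Ξ τ κ → Red Δ Ξ A (sub σ τ κ M)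

  redEnvλ-▹ : ∀ {Γ Δ Ξ A N σ} → Red Δ Ξ A N → RedEnvλ Γ Δ Ξ σ → RedEnvλ (A ∷ Γ) Δ Ξ (N ▹ σ)
  redEnvλ-▹ rN Hσ here      = rN
  redEnvλ-▹ rN Hσ (there r) = Hσ r

  redEnvμ-▹ : ∀ {Θ Δ Ξ A C γ Ns τ κ} → Ξ ∋ γ ∶ C → RedArgs Δ Ξ A Ns C → RedEnvμ Θ Δ Ξ τ κ
            → RedEnvμ (A ∷ Θ) Δ Ξ (γ ▹ τ) (Ns ▹ κ)
  redEnvμ-▹ {C = C} r rs Hτ here       = C , r , rs
  redEnvμ-▹         r rs Hτ (there r') = Hτ r'

  red-λbody : ∀ {Γ Θ M A A' Δ Ξ σ τ κ} → (A ∷ Γ) ⊨ M ∶ A' ︔ Θ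
            → RedEnvλ Γ Δ Ξ σ → RedEnvμ Θ Δ Ξ τ κ
            → Red (Δ ++ A ∷ []) Ξ A' (sub (var (length Δ) ▹ σ) τ κ M)
  red-λbody {Δ = Δ} ih Hσ Hτ =
    ih (redEnvλ-▹ (red-var (∋-last Δ)) (redEnvλ-⊑ ⊑-++ ⊑-refl Hσ)) (redEnvμ-⊑ ⊑-++ ⊑-refl Hτ)

  absλ-λbody : ∀ {Γ Θ M A A' Δ Ξ σ τ κ} → (A ∷ Γ) ⊢ M ∶ A' ︔ Θ
             → RedEnvλ Γ Δ Ξ σ → RedEnvμ Θ Δ Ξ τ κ
             → absλ (length Δ) (sub (var (length Δ) ▹ σ) τ κ M) ≡ sub σ τ κ (lam M)
  absλ-λbody d Hσ Hτ = absλ-sub _ d (λ r → freshλ (proj₁ (Hσ r)))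
                                    (λ r → freshλ-args (redArgs-typed (proj₂ (proj₂ (Hτ r)))))

  red-μbody : ∀ {Γ Θ M A C Δ Ξ σ τ κ Ns} → Γ ⊨ M ∶ bot ︔ (A ∷ Θ)
            → RedEnvλ Γ Δ Ξ σ → RedEnvμ Θ Δ Ξ τ κ → RedArgs Δ Ξ A Ns C
            → Red Δ (Ξ ++ C ∷ []) bot (sub σ (length Ξ ▹ τ) (Ns ▹ κ) M)
  red-μbody {Ξ = Ξ} ih Hσ Hτ rs =
    ih (redEnvλ-⊑ ⊑-refl ⊑-++ Hσ)
       (redEnvμ-▹ (∋-last Ξ) (redArgs-⊑ ⊑-refl ⊑-++ rs) (redEnvμ-⊑ ⊑-refl ⊑-++ Hτ))

  absμ-μbody : ∀ {Γ Θ M A C Δ Ξ σ τ κ Ns} → Γ ⊢ M ∶ bot ︔ (A ∷ Θ)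
             → RedEnvλ Γ Δ Ξ σ → RedEnvμ Θ Δ Ξ τ κ → RedArgs Δ Ξ A Ns C
             → absμ (length Ξ) (sub σ (length Ξ ▹ τ) (Ns ▹ κ) M) ≡ mu (subμ σ τ κ Ns M)
  absμ-μbody {Ξ = Ξ} d Hσ Hτ rs =
    absμ-sub _ _ d (λ r → freshμ (proj₁ (Hσ r)))
                   (λ r → absRen-fresh Ξ (proj₁ (proj₂ (Hτ r))))
                   (λ r → freshμ-args (redArgs-typed (proj₂ (proj₂ (Hτ r)))))
                   (freshμ-args (redArgs-typed rs))

  β-redex-inB : ∀ {Γ Θ M A A' Δ Ξ σ τ κ N Ns C} → (A ∷ Γ) ⊨ M ∶ A' ︔ Θ
              → Δ ⊢ sub σ τ κ (lam M) ∶ A ⇒ A' ︔ Ξ → RedEnvλ Γ Δ Ξ σ → RedEnvμ Θ Δ Ξ τ κ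
              → Red Δ Ξ A N → RedArgs Δ Ξ A' Ns C → B (apps (app (sub σ τ κ (lam M)) N) Ns)
  β-redex-inB {M = M} {σ = σ} {τ} {κ} {N} {Ns} {C} ih dλ Hσ Hτ rN rs =
    C5 _ N Ns (typable-lam⁻ dλ) (typable (proj₁ rN)) (typedArgs-typable (redArgs-typed rs))
       (red-inB rN) (typable (⊢-apps (⊢app dλ (proj₁ rN)) (redArgs-typed rs)))
       (subst (λ t → B (apps t Ns)) (sym (sub-β σ τ κ N M))
              (proj₂ (ih (redEnvλ-▹ rN Hσ) Hτ) ⊑-refl ⊑-refl C Ns rs))

  red-lam : ∀ {Γ Θ M A A'} → (A ∷ Γ) ⊢ M ∶ A' ︔ Θ → (A ∷ Γ) ⊨ M ∶ A' ︔ Θ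
          → Γ ⊨ lam M ∶ A ⇒ A' ︔ Θ
  red-lam {Γ} {Θ} {M} {A} {A'} d ih {Δ} {Ξ} {σ} {τ} {κ} Hσ Hτ = dλ , inB
    where
    dλ : Δ ⊢ sub σ τ κ (lam M) ∶ A ⇒ A' ︔ Ξ
    dλ = subst (λ t → Δ ⊢ t ∶ A ⇒ A' ︔ Ξ) (absλ-λbody d Hσ Hτ)
               (⊢-absλ (proj₁ (red-λbody {M = M} ih Hσ Hτ)))
    inB : AppsInB Δ Ξ (A ⇒ A') (sub σ τ κ (lam M))
    inB {Δ'} {Ξ'} p q C [] refl =
      subst B (absλ-λbody d Hσ' Hτ') (C1 _ _ (red-inB (red-λbody {M = M} ih Hσ' Hτ')))
      where
      Hσ' : RedEnvλ Γ Δ' Ξ' σ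
      Hσ' = redEnvλ-⊑ p q Hσ
      Hτ' : RedEnvμ Θ Δ' Ξ' τ κ
      Hτ' = redEnvμ-⊑ p q Hτ
    inB p q C (N ∷ Ns) (rN , rs) =
      β-redex-inB {M = M} ih (⊢-⊑ p q dλ) (redEnvλ-⊑ p q Hσ) (redEnvμ-⊑ p q Hτ) rN rs

  μ-contractum-inB : ∀ {Γ Θ M A C Δ Ξ σ τ κ Ns} → Γ ⊢ M ∶ bot ︔ (A ∷ Θ) → Γ ⊨ M ∶ bot ︔ (A ∷ Θ)
                   → RedEnvλ Γ Δ Ξ σ → RedEnvμ Θ Δ Ξ τ κ → RedArgs Δ Ξ A Ns C
                   → B (mu (subμ σ τ κ Ns M))
  μ-contractum-inB {M = M} {C = C} {Δ} {Ξ} {σ} {τ} {κ} {Ns} d ih Hσ Hτ rs =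
    subst B (absμ-μbody d Hσ Hτ rs) (C2 _ _ (red-inB body) (typable (⊢-absμ (proj₁ body))))
    where
    body : Red Δ (Ξ ++ C ∷ []) bot (sub σ (length Ξ ▹ τ) (Ns ▹ κ) M)
    body = red-μbody {M = M} ih Hσ Hτ rs

  red-mu : ∀ {Γ Θ M A} → Γ ⊢ M ∶ bot ︔ (A ∷ Θ) → Γ ⊨ M ∶ bot ︔ (A ∷ Θ) → Γ ⊨ mu M ∶ A ︔ Θ
  red-mu {M = M} {A} d ih {Δ} {Ξ} {σ} {τ} {κ} Hσ Hτ = dμ , inB
    where
    dμ : Δ ⊢ sub σ τ κ (mu M) ∶ A ︔ Ξ
    dμ = subst (λ t → Δ ⊢ t ∶ A ︔ Ξ) (absμ-μbody d Hσ Hτ refl)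
               (⊢-absμ (proj₁ (red-μbody {M = M} ih Hσ Hτ refl)))
    inB : AppsInB Δ Ξ A (sub σ τ κ (mu M))
    inB p q C Ns rs =
      C6 _ Ns (typable-mu⁻ dμ) (redArgs-inB rs) (typable (⊢-apps (⊢-⊑ p q dμ) (redArgs-typed rs)))
         (subst (λ t → B (mu t)) (sym (structSubs-subμ σ τ κ [] Ns M))
                (μ-contractum-inB d ih (redEnvλ-⊑ p q Hσ) (redEnvμ-⊑ p q Hτ) rs))

  fundamental : ∀ {Γ Θ M A} → Γ ⊢ M ∶ A ︔ Θ → Γ ⊨ M ∶ A ︔ Θ
  fundamental (⊢var r)    Hσ Hτ = Hσ r
  fundamental (⊢lam d)          = red-lam d (fundamental d)
  fundamental (⊢app d e)  Hσ Hτ = red-app (fundamental d Hσ Hτ) (fundamental e Hσ Hτ)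
  fundamental (⊢name r d) Hσ Hτ with Hτ r
  ... | C , r' , rs = red-name r' (fundamental d Hσ Hτ) rs
  fundamental (⊢mu d)           = red-mu d (fundamental d)

  typable⇒B : ∀ M → Typable M → B M
  typable⇒B M (Γ , Θ , _ , d) =
    subst B (sub-id (λ _ → refl) (λ _ → refl) (λ _ → refl) M)
            (red-inB (fundamental d red-var idEnvμ))
    where
    idEnvμ : RedEnvμ Θ Γ Θ id (const [])
    idEnvμ {A = A} r = A , r , refl

corollary3p16 : (B : Term → Set) → Saturated B
    → ((M : Term) → Typable M → B M) × ((M : Term) → B M → Typable M)
corollary3p16 B S = Reducibility.typable⇒B B S , Saturated.⊆typable S
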